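{- Let $q$ be an indeterminate, $s$ a parameter, and $$h_n(x,s,q)=\sum_{k=0}^{\lfloor n/2\rfloor}s^k q^{\binom{k}{2}}\frac{[n]_q!}{[k]_q!\,[n-2k]_q!}\,x^{n-2k}.$$ Then for all $n\ge 2$, $$h_n(x,s,q)=x\,h_{n-1}(x,s,q)+q^{n-2}(1+q)[n-1]_q\,s\,h_{n-2}(x,s,q)+(1-q)q^{n-3}s^2[n-1]_q[n-2]_q[n-3]_q\,h_{n-4}(x,s,q),$$ where $h_j:=0$ for $j<0$.
   Context: $[n]_q=\frac{1-q^n}{1-q}$ (so $[0]_q=0$), $[n]_q!=[1]_q\cdots[n]_q$, $[0]_q!=1$. -}

module Defs where

open import Level using (Level)
open import Algebra.Bundles using (CommutativeRing)
open import Data.Nat as ℕ using (ℕ; zero; suc; ⌊_/2⌋; _∸_)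
open import Data.Nat.Combinatorics using (_C_)

-- Everything is parameterised by a commutative ring R and elements q x s of R.
-- (A polynomial identity in ℤ[q,x,s] / ℚ(q)[x,s] holds iff it holds for all such
-- evaluations.)
module QHermite {c ℓ : Level} (R : CommutativeRing c ℓ) where
  open CommutativeRing R

  pow : Carrier → ℕ → Carrier
  pow a zero    = 1#
  pow a (suc n) = a * pow a n

  sumTo : ℕ → (ℕ → Carrier) → Carrier
  sumTo zero    f = f 0
  sumTo (suc m) f = sumTo m f + f (suc m)

  qint : Carrier → ℕ → Carrier
  qint q zero    = 0#
  qint q (suc n) = 1# + q * qint q n

  qfact : Carrier → ℕ → Carrier
  qfact q zero    = 1#
  qfact q (suc n) = qfact q n * qint q (suc n)

  -- h_n(x,s,q) = Σ_{k=0}^{⌊n/2⌋} s^k q^{binom(k,2)} c(n,k) x^{n-2k},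
  -- where cf n k plays the role of [n]_q! / ([k]_q! [n-2k]_q!).
  h : (q x s : Carrier) → (cf : ℕ → ℕ → Carrier) → ℕ → Carrier
  h q x s cf n =
    sumTo ⌊ n /2⌋ (λ k → pow s k * pow q (k C 2) * cf n k * pow x (n ∸ (k ℕ.+ k)))

  -- (1-q) q^{n-3} s^2 [n-1]_q [n-2]_q [n-3]_q h_{n-4}, which is 0 for n < 4
  -- (since h_j := 0 for j < 0).
  lastTerm : (q x s : Carrier) → (cf : ℕ → ℕ → Carrier) → ℕ → Carrier
  lastTerm q x s cf (suc (suc (suc (suc m)))) =
    (1# - q) * pow q (suc m) * pow s 2
      * qint q (suc (suc (suc m))) * qint q (suc (suc m)) * qint q (suc m)
      * h q x s cf m
  lastTerm q x s cf _ = 0#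

-- Compare coefficients of s^k x^r on both sides. After multiplying by [k]_q! [r]_q!, which is
-- cancellable, every coefficient of h becomes a q-factorial, and for k ≥ 2 the comparison reduces
-- to [2k]_q = [k]_q (1 + q^k) with 1 written as (1-q)[k-1]_q + q^(k-1); for k = 0, 1 the last
-- term does not contribute and the comparison is [n]_q = [n-2]_q + q^(n-2) [2]_q or trivial.
module Submission where

open import Defs
open import Level using (Level)
open import Algebra.Bundles using (CommutativeRing)
open import Data.Nat as ℕ using (ℕ; zero; suc; _≤_; _<_; _∸_; _≤?_; ⌊_/2⌋; z≤n; s≤s)
import Data.Nat.Properties as ℕₚ
open import Data.Nat.Combinatorics using (_C_; nC1≡n; nCk+nC[k+1]≡[n+1]C[k+1])
open import Data.Nat.Tactic.RingSolver using (solve-∀)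
open import Data.Product using (_,_)
open import Data.Sum using (inj₁; inj₂)
open import Relation.Nullary using (yes; no)
open import Relation.Nullary.Negation using (contradiction)
open import Relation.Binary.PropositionalEquality as ≡ using (_≡_)
import Algebra.Properties.CommutativeSemigroup as CommutativeSemigroupProperties
import Algebra.Properties.Group as GroupProperties
import Algebra.Solver.Ring.NaturalCoefficients.Default as NaturalCoefficientSolver

suc-C2 : ∀ k → suc k C 2 ≡ k C 2 ℕ.+ k
suc-C2 k = ≡.trans (≡.sym (nCk+nC[k+1]≡[n+1]C[k+1] k 1))
                   (≡.trans (≡.cong (ℕ._+ k C 2) (nC1≡n k)) (ℕₚ.+-comm k (k C 2)))

k≤⌊n/2⌋⇒k+k≤n : ∀ {n k} → k ≤ ⌊ n /2⌋ → k ℕ.+ k ≤ n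
k≤⌊n/2⌋⇒k+k≤n {n} k≤ = ℕₚ.≤-trans (ℕₚ.+-mono-≤ k≤ (ℕₚ.≤-trans k≤ (ℕₚ.⌊n/2⌋≤⌈n/2⌉ n)))
                                   (ℕₚ.≤-reflexive (ℕₚ.⌊n/2⌋+⌈n/2⌉≡n n))

⌊n/2⌋<k⇒n<k+k : ∀ {n k} → ⌊ n /2⌋ < k → n < k ℕ.+ k
⌊n/2⌋<k⇒n<k+k {n} {k} lt = ℕₚ.≰⇒> λ k+k≤n →
  ℕₚ.<⇒≱ lt (≡.subst (_≤ ⌊ n /2⌋) (≡.sym (ℕₚ.n≡⌊n+n/2⌋ k)) (ℕₚ.⌊n/2⌋-mono k+k≤n))

module Recurrence {c ℓ : Level} (R : CommutativeRing c ℓ) where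
  open CommutativeRing R
  open QHermite R
  open CommutativeSemigroupProperties *-commutativeSemigroup using (xy∙z≈y∙xz; xy∙z≈xz∙y; xy∙z≈yz∙x)
  open CommutativeSemigroupProperties +-commutativeSemigroup using () renaming (interchange to +-interchange)
  open GroupProperties +-group using (//-rightDividesˡ)
  open import Relation.Binary.Reasoning.Setoid setoid
  open NaturalCoefficientSolver commutativeSemiring using (solve; _:=_; con; _:+_; _:*_)

  *-distribˡ-+₃ : ∀ a b c d → a * (b + c + d) ≈ a * b + a * c + a * d
  *-distribˡ-+₃ a b c d = trans (distribˡ a (b + c) d) (+-congʳ (distribˡ a b c))

  +-zero₃ : ∀ {a b c} → a ≈ 0# → b ≈ 0# → c ≈ 0# → a + b + c ≈ 0#
  +-zero₃ a≈0 b≈0 c≈0 = trans (+-cong (+-cong a≈0 b≈0) c≈0) (trans (+-identityʳ _) (+-identityʳ _))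

  *-zeroʳ-≈ : ∀ a {b} → b ≈ 0# → a * b ≈ 0#
  *-zeroʳ-≈ a b≈0 = trans (*-congˡ b≈0) (zeroʳ a)

  sumTo-cong : ∀ m {f g : ℕ → Carrier} → (∀ k → k ≤ m → f k ≈ g k) → sumTo m f ≈ sumTo m g
  sumTo-cong zero    f≈g = f≈g 0 z≤n
  sumTo-cong (suc m) f≈g =
    +-cong (sumTo-cong m (λ k k≤m → f≈g k (ℕₚ.m≤n⇒m≤1+n k≤m))) (f≈g (suc m) ℕₚ.≤-refl)

  sumTo-+ : ∀ m (f g : ℕ → Carrier) → sumTo m (λ k → f k + g k) ≈ sumTo m f + sumTo m g
  sumTo-+ zero    f g = refl
  sumTo-+ (suc m) f g = trans (+-congʳ (sumTo-+ m f g)) (+-interchange _ _ _ _)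

  sumTo-*ˡ : ∀ m a (f : ℕ → Carrier) → sumTo m (λ k → a * f k) ≈ a * sumTo m f
  sumTo-*ˡ zero    a f = refl
  sumTo-*ˡ (suc m) a f = trans (+-congʳ (sumTo-*ˡ m a f)) (sym (distribˡ a _ _))

  sumTo-zero : ∀ m → sumTo m (λ _ → 0#) ≈ 0#
  sumTo-zero zero    = refl
  sumTo-zero (suc m) = trans (+-identityʳ _) (sumTo-zero m)

  sumTo-extend : ∀ {m n} (f : ℕ → Carrier) → m ≤ n → (∀ k → m < k → f k ≈ 0#) →
                 sumTo n f ≈ sumTo m f
  sumTo-extend {n = zero}  f z≤n   _      = refl
  sumTo-extend {m} {suc n} f m≤1+n vanish with ℕₚ.m≤n⇒m<n∨m≡n m≤1+n
  ... | inj₁ m<1+n  = trans (+-cong (sumTo-extend f (ℕₚ.≤-pred m<1+n) vanish) (vanish (suc n) m<1+n))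
                            (+-identityʳ _)
  ... | inj₂ ≡.refl = refl

  shift : (ℕ → Carrier) → ℕ → Carrier
  shift f zero    = 0#
  shift f (suc k) = f k

  sumTo-shift : ∀ m (f : ℕ → Carrier) → sumTo (suc m) (shift f) ≈ sumTo m f
  sumTo-shift zero    f = +-identityˡ (f 0)
  sumTo-shift (suc m) f = +-congʳ (sumTo-shift m f)

  pow-+ : ∀ a m n → pow a (m ℕ.+ n) ≈ pow a m * pow a n
  pow-+ a zero    n = sym (*-identityˡ _)
  pow-+ a (suc m) n = trans (*-congˡ (pow-+ a m n)) (sym (*-assoc _ _ _))

  qint-+ : ∀ q m n → qint q (m ℕ.+ n) ≈ qint q m + pow q m * qint q n
  qint-+ q zero    n = sym (trans (+-identityˡ _) (*-identityˡ _))
  qint-+ q (suc m) n = begin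
    1# + q * qint q (m ℕ.+ n)                      ≈⟨ +-congˡ (*-congˡ (qint-+ q m n)) ⟩
    1# + q * (qint q m + pow q m * qint q n)       ≈⟨ solve 4 (λ q a b c → con 1 :+ q :* (a :+ b :* c)
                                                              := (con 1 :+ q :* a) :+ (q :* b) :* c)
                                                            refl q _ _ _ ⟩
    (1# + q * qint q m) + (q * pow q m) * qint q n ∎

  qint-complement : ∀ q n → (1# - q) * qint q n + pow q n ≈ 1#
  qint-complement q zero    = trans (+-congʳ (zeroʳ _)) (+-identityˡ _)
  qint-complement q (suc n) = begin
    (1# - q) * (1# + q * qint q n) + q * pow q n ≈⟨ solve 4 (λ d q b v → d :* (con 1 :+ q :* b) :+ q :* v
                                                            := d :+ q :* (d :* b :+ v))
                                                          refl (1# - q) q _ _ ⟩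
    (1# - q) + q * ((1# - q) * qint q n + pow q n) ≈⟨ +-congˡ (*-congˡ (qint-complement q n)) ⟩
    (1# - q) + q * 1#                              ≈⟨ +-congˡ (*-identityʳ q) ⟩
    (1# - q) + q                                   ≈⟨ //-rightDividesˡ q 1# ⟩
    1#                                             ∎

  qint-double : ∀ q j →
    qint q (suc j ℕ.+ suc j) ≈ qint q (suc j) * ((1# - q) * qint q j + pow q j * (1# + q))
  qint-double q j = begin
    qint q (suc j ℕ.+ suc j)                  ≈⟨ qint-+ q (suc j) (suc j) ⟩
    [k] + (q * u) * [k]                       ≈⟨ solve 3 (λ a q u → a :+ (q :* u) :* a := a :* (con 1 :+ q :* u))
                                                       refl [k] q u ⟩
    [k] * (1# + q * u)                        ≈⟨ *-congˡ (+-congʳ (sym (qint-complement q j))) ⟩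
    [k] * (((1# - q) * qint q j + u) + q * u) ≈⟨ *-congˡ (solve 3 (λ a u q → (a :+ u) :+ q :* u
                                                                  := a :+ u :* (con 1 :+ q))
                                                                refl _ u q) ⟩
    [k] * ((1# - q) * qint q j + u * (1# + q)) ∎
    where
    [k] = qint q (suc j)
    u   = pow q j

  -- The recurrence for the coefficient of s^(j+2) x^r in h_(2j+4+r), multiplied by [j+2]! [r]!
  -- and divided by [2j+3+r]! s^(j+2) q^binom(j+1,2) x^r.
  qint-coefficient-identity : ∀ q j r →
    qint q (4 ℕ.+ (j ℕ.+ j ℕ.+ r)) * pow q (suc j)
      ≈ qint q r * pow q (suc j)
        + pow q (2 ℕ.+ (j ℕ.+ j ℕ.+ r)) * (1# + q) * qint q (suc (suc j))
        + (1# - q) * pow q (suc (j ℕ.+ r)) * qint q (suc (suc j)) * qint q (suc j)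
  qint-coefficient-identity q j r = begin
    qint q (4 ℕ.+ (j ℕ.+ j ℕ.+ r)) * u
      ≡⟨ ≡.cong (λ n → qint q n * u) (index j r) ⟩
    qint q (r ℕ.+ (suc (suc j) ℕ.+ suc (suc j))) * u
      ≈⟨ *-congʳ (trans (qint-+ q r _) (+-congˡ (*-congˡ (qint-double q (suc j))))) ⟩
    (qint q r + v * (K₂ * ((1# - q) * K₁ + u * (1# + q)))) * u
      ≈⟨ solve 7 (λ b v k₂ d k₁ u q → (b :+ v :* (k₂ :* (d :* k₁ :+ u :* (con 1 :+ q)))) :* u
                   := b :* u :+ (u :* (v :* u)) :* (con 1 :+ q) :* k₂ :+ d :* (v :* u) :* k₂ :* k₁)
               refl _ v K₂ (1# - q) K₁ u q ⟩
    qint q r * u + (u * (v * u)) * (1# + q) * K₂ + (1# - q) * (v * u) * K₂ * K₁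
      ≈⟨ sym (+-cong (+-congˡ (*-congʳ (*-congʳ pow-[2k+r-2])))
                     (*-congʳ (*-congʳ (*-congˡ pow-[k+r-1])))) ⟩
    qint q r * u + pow q (2 ℕ.+ (j ℕ.+ j ℕ.+ r)) * (1# + q) * K₂
      + (1# - q) * pow q (suc (j ℕ.+ r)) * K₂ * K₁ ∎
    where
    u  = pow q (suc j)
    v  = pow q r
    K₁ = qint q (suc j)
    K₂ = qint q (suc (suc j))
    index : ∀ j r → 4 ℕ.+ (j ℕ.+ j ℕ.+ r) ≡ r ℕ.+ (suc (suc j) ℕ.+ suc (suc j))
    index = solve-∀
    pow-[2k+r-2] : pow q (2 ℕ.+ (j ℕ.+ j ℕ.+ r)) ≈ u * (v * u)
    pow-[2k+r-2] = begin
      pow q (2 ℕ.+ (j ℕ.+ j ℕ.+ r))     ≡⟨ ≡.cong (pow q) (split j r) ⟩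
      pow q (suc j ℕ.+ (r ℕ.+ suc j))   ≈⟨ trans (pow-+ q (suc j) _) (*-congˡ (pow-+ q r (suc j))) ⟩
      u * (v * u)                        ∎
      where
      split : ∀ j r → 2 ℕ.+ (j ℕ.+ j ℕ.+ r) ≡ suc j ℕ.+ (r ℕ.+ suc j)
      split = solve-∀
    pow-[k+r-1] : pow q (suc (j ℕ.+ r)) ≈ v * u
    pow-[k+r-1] = trans (reflexive (≡.cong (pow q) (split j r))) (pow-+ q r (suc j))
      where
      split : ∀ j r → suc (j ℕ.+ r) ≡ r ℕ.+ suc j
      split = solve-∀

  module Coefficients
    (q x s : Carrier)
    (qint-cancel : ∀ j a b → qint q (suc j) * a ≈ qint q (suc j) * b → a ≈ b)
    (cf : ℕ → ℕ → Carrier)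
    (cf-spec : ∀ n k → k ℕ.+ k ≤ n → qfact q k * qfact q (n ∸ (k ℕ.+ k)) * cf n k ≈ qfact q n)
    where

    qfact-cancel : ∀ k {a b} → qfact q k * a ≈ qfact q k * b → a ≈ b
    qfact-cancel zero    {a} {b} e = trans (sym (*-identityˡ a)) (trans e (*-identityˡ b))
    qfact-cancel (suc k) {a} {b} e =
      qfact-cancel k (qint-cancel k _ _ (trans (sym (xy∙z≈y∙xz _ _ a)) (trans e (xy∙z≈y∙xz _ _ b))))

    cancel-by-scaling : ∀ k r Φ {a b c d α β γ δ} →
      (qfact q k * qfact q r) * a ≈ Φ * α →
      (qfact q k * qfact q r) * b ≈ Φ * β →
      (qfact q k * qfact q r) * c ≈ Φ * γ →
      (qfact q k * qfact q r) * d ≈ Φ * δ →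
      α ≈ β + γ + δ → a ≈ b + c + d
    cancel-by-scaling k r Φ {a} {b} {c} {d} {α} {β} {γ} {δ} Fa Fb Fc Fd α≈β+γ+δ =
      qfact-cancel r (qfact-cancel k (trans (sym (*-assoc _ _ a)) (trans scaled (*-assoc _ _ _))))
      where
      F = qfact q k * qfact q r
      scaled : F * a ≈ F * (b + c + d)
      scaled = begin
        F * a                 ≈⟨ Fa ⟩
        Φ * α                 ≈⟨ *-congˡ α≈β+γ+δ ⟩
        Φ * (β + γ + δ)       ≈⟨ *-distribˡ-+₃ Φ β γ δ ⟩
        Φ * β + Φ * γ + Φ * δ ≈⟨ sym (+-cong (+-cong Fb Fc) Fd) ⟩
        F * b + F * c + F * d ≈⟨ sym (*-distribˡ-+₃ F b c d) ⟩
        F * (b + c + d)       ∎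

    -- Cut off outside 2k ≤ n, where cf n k is unconstrained, so that sums may run past ⌊n/2⌋.
    hTerm : ℕ → ℕ → Carrier
    hTerm n k with k ℕ.+ k ≤? n
    ... | yes _ = pow s k * pow q (k C 2) * cf n k * pow x (n ∸ (k ℕ.+ k))
    ... | no  _ = 0#

    hTerm-within : ∀ {n} k → k ℕ.+ k ≤ n →
                   hTerm n k ≈ pow s k * pow q (k C 2) * cf n k * pow x (n ∸ (k ℕ.+ k))
    hTerm-within {n} k k+k≤n with k ℕ.+ k ≤? n
    ... | yes _    = refl
    ... | no k+k≰n = contradiction k+k≤n k+k≰n

    hTerm-beyond : ∀ {n} k → n < k ℕ.+ k → hTerm n k ≈ 0#
    hTerm-beyond {n} k n<k+k with k ℕ.+ k ≤? n
    ... | yes k+k≤n = contradiction k+k≤n (ℕₚ.<⇒≱ n<k+k)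
    ... | no _      = refl

    h≈sumTo-hTerm : ∀ {n m} → n ≤ m → h q x s cf n ≈ sumTo m (hTerm n)
    h≈sumTo-hTerm {n} {m} n≤m = begin
      h q x s cf n            ≈⟨ sumTo-cong ⌊ n /2⌋ (λ k k≤ → sym (hTerm-within k (k≤⌊n/2⌋⇒k+k≤n k≤))) ⟩
      sumTo ⌊ n /2⌋ (hTerm n) ≈⟨ sym (sumTo-extend (hTerm n) (ℕₚ.≤-trans (ℕₚ.⌊n/2⌋≤n n) n≤m)
                                                    (λ k lt → hTerm-beyond k (⌊n/2⌋<k⇒n<k+k lt))) ⟩
      sumTo m (hTerm n)       ∎

    monomial : ℕ → ℕ → Carrier
    monomial k r = pow s k * pow q (k C 2) * pow x r

    monomial-suc : ∀ j r → monomial (suc j) r ≈ s * (pow q j * monomial j r)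
    monomial-suc j r = begin
      s * pow s j * pow q (suc j C 2) * pow x r
        ≡⟨ ≡.cong (λ e → s * pow s j * pow q e * pow x r) (suc-C2 j) ⟩
      s * pow s j * pow q (j C 2 ℕ.+ j) * pow x r
        ≈⟨ *-congʳ (*-congˡ (pow-+ q (j C 2) j)) ⟩
      s * pow s j * (pow q (j C 2) * pow q j) * pow x r
        ≈⟨ solve 5 (λ s a b u y → s :* a :* (b :* u) :* y := s :* (u :* (a :* b :* y))) refl s _ _ _ _ ⟩
      s * (pow q j * monomial j r) ∎

    qfact-scales-hTerm : ∀ {n} k r → k ℕ.+ k ℕ.+ r ≡ n →
                         (qfact q k * qfact q r) * hTerm n k ≈ qfact q n * monomial k r
    qfact-scales-hTerm k r ≡.refl = begin
      F * hTerm n k                                             ≈⟨ *-congˡ (hTerm-within k k+k≤n) ⟩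
      F * (pow s k * pow q (k C 2) * cf n k * pow x (n ∸ (k ℕ.+ k)))
        ≡⟨ ≡.cong (λ e → F * (pow s k * pow q (k C 2) * cf n k * pow x e)) n-k-k≡r ⟩
      F * (pow s k * pow q (k C 2) * cf n k * pow x r)
        ≈⟨ solve 5 (λ f a b c y → f :* (a :* b :* c :* y) := (f :* c) :* (a :* b :* y)) refl F _ _ _ _ ⟩
      (F * cf n k) * monomial k r                               ≈⟨ *-congʳ F*cf≈qfact ⟩
      qfact q n * monomial k r                                  ∎
      where
      n = k ℕ.+ k ℕ.+ r
      F = qfact q k * qfact q r
      k+k≤n : k ℕ.+ k ≤ n
      k+k≤n = ℕₚ.m≤m+n (k ℕ.+ k) r
      n-k-k≡r : n ∸ (k ℕ.+ k) ≡ r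
      n-k-k≡r = ℕₚ.m+n∸m≡n (k ℕ.+ k) r
      F*cf≈qfact : F * cf n k ≈ qfact q n
      F*cf≈qfact = ≡.subst (λ e → qfact q k * qfact q e * cf n k ≈ qfact q n) n-k-k≡r (cf-spec n k k+k≤n)

    qfact-scales-x-hTerm : ∀ {n} k r → k ℕ.+ k ℕ.+ r ≡ suc n →
                           (qfact q k * qfact q r) * (x * hTerm n k) ≈ qint q r * qfact q n * monomial k r
    qfact-scales-x-hTerm {n} k zero e =
      trans (*-zeroʳ-≈ _ (*-zeroʳ-≈ x (hTerm-beyond k n<k+k))) (sym (trans (*-congʳ (zeroˡ _)) (zeroˡ _)))
      where
      n<k+k : n < k ℕ.+ k
      n<k+k = ℕₚ.≤-reflexive (≡.trans (≡.sym e) (ℕₚ.+-identityʳ (k ℕ.+ k)))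
    qfact-scales-x-hTerm {n} k (suc r) e = begin
      (qfact q k * (qfact q r * qint q (suc r))) * (x * hTerm n k)
        ≈⟨ solve 5 (λ a b i y t → (a :* (b :* i)) :* (y :* t) := (i :* y) :* ((a :* b) :* t)) refl _ _ _ x _ ⟩
      (qint q (suc r) * x) * ((qfact q k * qfact q r) * hTerm n k)
        ≈⟨ *-congˡ (qfact-scales-hTerm k r k+k+r≡n) ⟩
      (qint q (suc r) * x) * (qfact q n * monomial k r)
        ≈⟨ solve 6 (λ i y g a b z → (i :* y) :* (g :* (a :* b :* z)) := i :* g :* (a :* b :* (y :* z)))
                 refl _ x _ _ _ _ ⟩
      qint q (suc r) * qfact q n * monomial k (suc r) ∎
      where
      k+k+r≡n : k ℕ.+ k ℕ.+ r ≡ n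
      k+k+r≡n = ℕₚ.suc-injective (≡.trans (≡.sym (ℕₚ.+-suc (k ℕ.+ k) r)) e)

    middleCoeff : ℕ → Carrier
    middleCoeff p = pow q p * (1# + q) * qint q (suc p)

    lastCoeff : ℕ → Carrier
    lastCoeff m = (1# - q) * pow q (suc m) * pow s 2
                  * qint q (suc (suc (suc m))) * qint q (suc (suc m)) * qint q (suc m)

    lastSummand : ℕ → ℕ → Carrier
    lastSummand p             zero          = 0#
    lastSummand p             (suc zero)    = 0#
    lastSummand (suc (suc m)) (suc (suc j)) = lastCoeff m * hTerm m j
    lastSummand _             _             = 0#

    sumTo-lastSummand : ∀ p → sumTo (suc (suc p)) (lastSummand p) ≈ lastTerm q x s cf (suc (suc p))
    sumTo-lastSummand zero          = sumTo-zero 2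
    sumTo-lastSummand (suc zero)    = sumTo-zero 3
    sumTo-lastSummand (suc (suc m)) = begin
      sumTo (4 ℕ.+ m) (lastSummand (2 ℕ.+ m))
        ≈⟨ sumTo-cong (4 ℕ.+ m) (λ k _ → as-shift k) ⟩
      sumTo (4 ℕ.+ m) (λ k → lastCoeff m * shift (shift (hTerm m)) k)
        ≈⟨ sumTo-*ˡ (4 ℕ.+ m) (lastCoeff m) _ ⟩
      lastCoeff m * sumTo (4 ℕ.+ m) (shift (shift (hTerm m)))
        ≈⟨ *-congˡ (trans (sumTo-shift (3 ℕ.+ m) _) (sumTo-shift (2 ℕ.+ m) _)) ⟩
      lastCoeff m * sumTo (2 ℕ.+ m) (hTerm m)
        ≈⟨ *-congˡ (sym (h≈sumTo-hTerm (ℕₚ.m≤n+m m 2))) ⟩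
      lastCoeff m * h q x s cf m ∎
      where
      as-shift : ∀ k → lastSummand (2 ℕ.+ m) k ≈ lastCoeff m * shift (shift (hTerm m)) k
      as-shift zero          = sym (zeroʳ _)
      as-shift (suc zero)    = sym (zeroʳ _)
      as-shift (suc (suc j)) = refl

    PointwiseRecurrence : ℕ → ℕ → Set ℓ
    PointwiseRecurrence p k =
      hTerm (suc (suc p)) k ≈ x * hTerm (suc p) k + middleCoeff p * s * shift (hTerm p) k + lastSummand p k

    scaled-zero : ∀ {F a} Φ → a ≈ 0# → F * a ≈ Φ * 0#
    scaled-zero Φ a≈0 = trans (*-zeroʳ-≈ _ a≈0) (sym (zeroʳ Φ))

    pointwise-0 : ∀ p → PointwiseRecurrence p 0
    pointwise-0 p = cancel-by-scaling 0 N Φ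
      (trans (qfact-scales-hTerm 0 N ≡.refl) (xy∙z≈xz∙y _ _ _))
      (trans (qfact-scales-x-hTerm 0 N ≡.refl) (xy∙z≈yz∙x _ _ _))
      (scaled-zero Φ (zeroʳ _))
      (scaled-zero Φ refl)
      (sym (trans (+-identityʳ _) (+-identityʳ _)))
      where
      N = suc (suc p)
      Φ = qfact q (suc p) * monomial 0 N

    pointwise-1 : ∀ p → PointwiseRecurrence p 1
    pointwise-1 p = cancel-by-scaling 1 p Φ scaled-term scaled-x-term scaled-middle-term (scaled-zero Φ refl) core
      where
      G  = qfact q p
      I₁ = qint q (suc p)
      I₂ = qint q (suc (suc p))
      W  = monomial 0 p
      Φ  = (G * I₁) * (s * W)

      scaled-term : (qfact q 1 * G) * hTerm (suc (suc p)) 1 ≈ Φ * I₂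
      scaled-term = begin
        (qfact q 1 * G) * hTerm (suc (suc p)) 1 ≈⟨ qfact-scales-hTerm 1 p ≡.refl ⟩
        ((G * I₁) * I₂) * monomial 1 p          ≈⟨ *-congˡ (monomial-suc 0 p) ⟩
        ((G * I₁) * I₂) * (s * (1# * W))        ≈⟨ solve 5 (λ g i₁ i₂ s w → ((g :* i₁) :* i₂) :* (s :* (con 1 :* w))
                                                               := ((g :* i₁) :* (s :* w)) :* i₂)
                                                             refl G I₁ I₂ s W ⟩
        Φ * I₂                                  ∎

      scaled-x-term : (qfact q 1 * G) * (x * hTerm (suc p) 1) ≈ Φ * qint q p
      scaled-x-term = begin
        (qfact q 1 * G) * (x * hTerm (suc p) 1) ≈⟨ qfact-scales-x-hTerm 1 p ≡.refl ⟩
        qint q p * (G * I₁) * monomial 1 p      ≈⟨ *-congˡ (monomial-suc 0 p) ⟩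
        qint q p * (G * I₁) * (s * (1# * W))    ≈⟨ solve 5 (λ b g i₁ s w → b :* (g :* i₁) :* (s :* (con 1 :* w))
                                                               := ((g :* i₁) :* (s :* w)) :* b)
                                                             refl _ G I₁ s W ⟩
        Φ * qint q p                            ∎

      scaled-middle-term : (qfact q 1 * G) * (middleCoeff p * s * hTerm p 0) ≈ Φ * (pow q p * (1# + q))
      scaled-middle-term = begin
        (qfact q 1 * G) * (middleCoeff p * s * hTerm p 0)
          ≈⟨ solve 6 (λ q g u i₁ s t → ((con 1 :* (con 1 :+ q :* con 0)) :* g) :* (u :* (con 1 :+ q) :* i₁ :* s :* t)
                          := (u :* (con 1 :+ q) :* i₁ :* s) :* ((con 1 :* g) :* t))
                     refl q G (pow q p) I₁ s _ ⟩
        (middleCoeff p * s) * ((qfact q 0 * G) * hTerm p 0) ≈⟨ *-congˡ (qfact-scales-hTerm 0 p ≡.refl) ⟩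
        (middleCoeff p * s) * (G * W)
          ≈⟨ solve 6 (λ u q i₁ s g w → (u :* (con 1 :+ q) :* i₁ :* s) :* (g :* w)
                          := ((g :* i₁) :* (s :* w)) :* (u :* (con 1 :+ q)))
                     refl (pow q p) q I₁ s G W ⟩
        Φ * (pow q p * (1# + q)) ∎

      core : I₂ ≈ qint q p + pow q p * (1# + q) + 0#
      core = begin
        I₂                                            ≡⟨ ≡.cong (qint q) (ℕₚ.+-comm 2 p) ⟩
        qint q (p ℕ.+ 2)                              ≈⟨ qint-+ q p 2 ⟩
        qint q p + pow q p * (1# + q * (1# + q * 0#)) ≈⟨ solve 3 (λ b u q → b :+ u :* (con 1 :+ q :* (con 1 :+ q :* con 0))
                                                                     := b :+ u :* (con 1 :+ q) :+ con 0)
                                                                   refl _ (pow q p) q ⟩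
        qint q p + pow q p * (1# + q) + 0#            ∎

    pointwise-within : ∀ j r → PointwiseRecurrence (2 ℕ.+ (j ℕ.+ j ℕ.+ r)) (suc (suc j))
    pointwise-within j r =
      cancel-by-scaling (suc (suc j)) r Φ scaled-term scaled-x-term scaled-middle-term scaled-last-term
                        (qint-coefficient-identity q j r)
      where
      M  = j ℕ.+ j ℕ.+ r
      u  = pow q (suc j)
      K₁ = qint q (suc j)
      K₂ = qint q (suc (suc j))
      G₀ = qfact q M
      I₁ = qint q (1 ℕ.+ M)
      I₂ = qint q (2 ℕ.+ M)
      I₃ = qint q (3 ℕ.+ M)
      I₄ = qint q (4 ℕ.+ M)
      W₀ = monomial j r
      W₁ = monomial (suc j) r
      Φ  = qfact q (3 ℕ.+ M) * (s * W₁)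

      index : ∀ j r → suc (suc j) ℕ.+ suc (suc j) ℕ.+ r ≡ 4 ℕ.+ (j ℕ.+ j ℕ.+ r)
      index = solve-∀

      scaled-term : (qfact q (suc (suc j)) * qfact q r) * hTerm (4 ℕ.+ M) (suc (suc j)) ≈ Φ * (I₄ * u)
      scaled-term = begin
        _                                              ≈⟨ qfact-scales-hTerm (suc (suc j)) r (index j r) ⟩
        (qfact q (3 ℕ.+ M) * I₄) * monomial (suc (suc j)) r ≈⟨ *-congˡ (monomial-suc (suc j) r) ⟩
        (qfact q (3 ℕ.+ M) * I₄) * (s * (u * W₁))      ≈⟨ solve 5 (λ g i s u w → (g :* i) :* (s :* (u :* w))
                                                                     := (g :* (s :* w)) :* (i :* u))
                                                                   refl _ I₄ s u W₁ ⟩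
        Φ * (I₄ * u)                                   ∎

      scaled-x-term : (qfact q (suc (suc j)) * qfact q r) * (x * hTerm (3 ℕ.+ M) (suc (suc j)))
                        ≈ Φ * (qint q r * u)
      scaled-x-term = begin
        _                                                  ≈⟨ qfact-scales-x-hTerm (suc (suc j)) r (index j r) ⟩
        qint q r * qfact q (3 ℕ.+ M) * monomial (suc (suc j)) r ≈⟨ *-congˡ (monomial-suc (suc j) r) ⟩
        qint q r * qfact q (3 ℕ.+ M) * (s * (u * W₁))      ≈⟨ solve 5 (λ b g s u w → b :* g :* (s :* (u :* w))
                                                                         := (g :* (s :* w)) :* (b :* u))
                                                                       refl _ _ s u W₁ ⟩
        Φ * (qint q r * u)                                 ∎

      scaled-middle-term : (qfact q (suc (suc j)) * qfact q r)
                             * (middleCoeff (2 ℕ.+ M) * s * hTerm (2 ℕ.+ M) (suc j))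
                             ≈ Φ * (pow q (2 ℕ.+ M) * (1# + q) * K₂)
      scaled-middle-term = begin
        _ ≈⟨ solve 6 (λ f k₂ f′ a s t → ((f :* k₂) :* f′) :* (a :* s :* t)
                          := (a :* s :* k₂) :* ((f :* f′) :* t))
                 refl (qfact q (suc j)) K₂ (qfact q r) _ s _ ⟩
        (middleCoeff (2 ℕ.+ M) * s * K₂) * ((qfact q (suc j) * qfact q r) * hTerm (2 ℕ.+ M) (suc j))
          ≈⟨ *-congˡ (qfact-scales-hTerm (suc j) r (index′ j r)) ⟩
        (middleCoeff (2 ℕ.+ M) * s * K₂) * (qfact q (2 ℕ.+ M) * W₁)
          ≈⟨ solve 7 (λ v q i₃ s k₂ g w → (v :* (con 1 :+ q) :* i₃ :* s :* k₂) :* (g :* w)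
                          := (g :* i₃ :* (s :* w)) :* (v :* (con 1 :+ q) :* k₂))
                     refl (pow q (2 ℕ.+ M)) q I₃ s K₂ _ W₁ ⟩
        Φ * (pow q (2 ℕ.+ M) * (1# + q) * K₂) ∎
        where
        index′ : ∀ j r → suc j ℕ.+ suc j ℕ.+ r ≡ 2 ℕ.+ (j ℕ.+ j ℕ.+ r)
        index′ = solve-∀

      scaled-last-term : (qfact q (suc (suc j)) * qfact q r) * (lastCoeff M * hTerm M j)
                           ≈ Φ * ((1# - q) * pow q (suc (j ℕ.+ r)) * K₂ * K₁)
      scaled-last-term = begin
        _ ≈⟨ solve 6 (λ f k₁ k₂ f′ l t → (((f :* k₁) :* k₂) :* f′) :* (l :* t)
                          := (l :* k₂ :* k₁) :* ((f :* f′) :* t))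
                 refl (qfact q j) K₁ K₂ (qfact q r) _ _ ⟩
        (lastCoeff M * K₂ * K₁) * ((qfact q j * qfact q r) * hTerm M j)
          ≈⟨ *-congˡ (qfact-scales-hTerm j r ≡.refl) ⟩
        (lastCoeff M * K₂ * K₁) * (G₀ * W₀)
          ≈⟨ *-congʳ (*-congʳ (*-congʳ lastCoeff-split)) ⟩
        ((1# - q) * (v * pow q j) * pow s 2 * I₃ * I₂ * I₁ * K₂ * K₁) * (G₀ * W₀)
          ≈⟨ solve 11 (λ d v w s i₃ i₂ i₁ k₂ k₁ g z →
                          (d :* (v :* w) :* (s :* (s :* con 1)) :* i₃ :* i₂ :* i₁ :* k₂ :* k₁) :* (g :* z)
                          := (g :* i₁ :* i₂ :* i₃ :* (s :* (s :* (w :* z)))) :* (d :* v :* k₂ :* k₁))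
                      refl (1# - q) v (pow q j) s I₃ I₂ I₁ K₂ K₁ G₀ W₀ ⟩
        (qfact q (3 ℕ.+ M) * (s * (s * (pow q j * W₀)))) * ((1# - q) * v * K₂ * K₁)
          ≈⟨ *-congʳ (*-congˡ (*-congˡ (sym (monomial-suc j r)))) ⟩
        Φ * ((1# - q) * v * K₂ * K₁) ∎
        where
        v = pow q (suc (j ℕ.+ r))
        split : ∀ j r → suc (j ℕ.+ j ℕ.+ r) ≡ suc (j ℕ.+ r) ℕ.+ j
        split = solve-∀
        lastCoeff-split : lastCoeff M ≈ (1# - q) * (v * pow q j) * pow s 2 * I₃ * I₂ * I₁
        lastCoeff-split = *-congʳ (*-congʳ (*-congʳ (*-congʳ (*-congˡ
          (trans (reflexive (≡.cong (pow q) (split j r))) (pow-+ q (suc (j ℕ.+ r)) j))))))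

    lastSummand-beyond : ∀ p j → p < 2 ℕ.+ (j ℕ.+ j) → lastSummand p (suc (suc j)) ≈ 0#
    lastSummand-beyond zero          j _  = refl
    lastSummand-beyond (suc zero)    j _  = refl
    lastSummand-beyond (suc (suc m)) j lt =
      *-zeroʳ-≈ (lastCoeff m) (hTerm-beyond j (ℕₚ.≤-pred (ℕₚ.≤-pred lt)))

    pointwise-beyond : ∀ p j → p < 2 ℕ.+ (j ℕ.+ j) → PointwiseRecurrence p (suc (suc j))
    pointwise-beyond p j p<2+2j =
      trans (hTerm-beyond (suc (suc j)) (double-bound 2+p<4+2j))
            (sym (+-zero₃ (*-zeroʳ-≈ x (hTerm-beyond (suc (suc j)) (double-bound 1+p<4+2j)))
                          (*-zeroʳ-≈ _ (hTerm-beyond (suc j) (≡.subst (p <_) (double-suc j) p<2+2j)))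
                          (lastSummand-beyond p j p<2+2j)))
      where
      double-suc : ∀ k → 2 ℕ.+ (k ℕ.+ k) ≡ suc k ℕ.+ suc k
      double-suc = solve-∀
      double-bound : ∀ {n} → n < 4 ℕ.+ (j ℕ.+ j) → n < suc (suc j) ℕ.+ suc (suc j)
      double-bound {n} = ≡.subst (n <_) (≡.trans (≡.cong (2 ℕ.+_) (double-suc j)) (double-suc (suc j)))
      2+p<4+2j : suc (suc p) < 4 ℕ.+ (j ℕ.+ j)
      2+p<4+2j = s≤s (s≤s p<2+2j)
      1+p<4+2j : suc p < 4 ℕ.+ (j ℕ.+ j)
      1+p<4+2j = ℕₚ.<-trans (ℕₚ.n<1+n (suc p)) 2+p<4+2j

    pointwise : ∀ p k → PointwiseRecurrence p k
    pointwise p zero          = pointwise-0 p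
    pointwise p (suc zero)    = pointwise-1 p
    pointwise p (suc (suc j)) with 2 ℕ.+ (j ℕ.+ j) ≤? p
    ... | no  2+2j≰p = pointwise-beyond p j (ℕₚ.≰⇒> 2+2j≰p)
    ... | yes 2+2j≤p with ℕₚ.m≤n⇒∃[o]m+o≡n 2+2j≤p
    ...   | r , ≡.refl = pointwise-within j r

    recurrence : ∀ p → h q x s cf (suc (suc p)) ≈
      x * h q x s cf (suc p) + middleCoeff p * s * h q x s cf p + lastTerm q x s cf (suc (suc p))
    recurrence p = begin
      h q x s cf n
        ≈⟨ h≈sumTo-hTerm {n} ℕₚ.≤-refl ⟩
      sumTo n (hTerm n)
        ≈⟨ sumTo-cong n (λ k _ → pointwise p k) ⟩
      sumTo n (λ k → x * hTerm (suc p) k + middleCoeff p * s * shift (hTerm p) k + lastSummand p k)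
        ≈⟨ trans (sumTo-+ n _ _) (+-congʳ (sumTo-+ n _ _)) ⟩
      sumTo n (λ k → x * hTerm (suc p) k) + sumTo n (λ k → middleCoeff p * s * shift (hTerm p) k)
        + sumTo n (lastSummand p)
        ≈⟨ +-cong (+-cong x-part middle-part) (sumTo-lastSummand p) ⟩
      x * h q x s cf (suc p) + middleCoeff p * s * h q x s cf p + lastTerm q x s cf n ∎
      where
      n = suc (suc p)
      x-part : sumTo n (λ k → x * hTerm (suc p) k) ≈ x * h q x s cf (suc p)
      x-part = trans (sumTo-*ˡ n x _) (*-congˡ (sym (h≈sumTo-hTerm (ℕₚ.n≤1+n (suc p)))))
      middle-part : sumTo n (λ k → middleCoeff p * s * shift (hTerm p) k) ≈ middleCoeff p * s * h q x s cf p
      middle-part = trans (sumTo-*ˡ n _ _)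
                          (*-congˡ (trans (sumTo-shift (suc p) _) (sym (h≈sumTo-hTerm (ℕₚ.n≤1+n p)))))

mainTheorem8 : ∀ {c ℓ : Level} (R : CommutativeRing c ℓ) →
    let open CommutativeRing R
        open QHermite R
    in (q x s : Carrier) →
       (∀ j a b → qint q (suc j) * a ≈ qint q (suc j) * b → a ≈ b) →
       (cf : ℕ → ℕ → Carrier) →
       (∀ n k → k ℕ.+ k ≤ n → qfact q k * qfact q (n ∸ (k ℕ.+ k)) * cf n k ≈ qfact q n) →
       ∀ n → 2 ≤ n →
       h q x s cf n ≈
         x * h q x s cf (n ∸ 1)
         + pow q (n ∸ 2) * (1# + q) * qint q (n ∸ 1) * s * h q x s cf (n ∸ 2)
         + lastTerm q x s cf n
mainTheorem8 R q x s qint-cancel cf cf-spec (suc (suc p)) _ =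
  Recurrence.Coefficients.recurrence R q x s qint-cancel cf cf-spec p
mainTheorem8 R q x s _ cf _ (suc zero) (s≤s ())
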